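{- Let $\pi=\pi_1\cdots\pi_n$ be a Fishburn permutation that avoids the classical pattern $321$. Then either $\pi_1=1$ or $\pi_2=1$.
   Context: A permutation of length $n$ is a rearrangement $\pi=\pi_1\cdots\pi_n$ of $[n]$. A permutation $\pi$ contains a classical pattern $p\in S_k$ if some subsequence of $\pi$ of length $k$ is order-isomorphic to $p$; otherwise it avoids $p$. A Fishburn permutation is a permutation $\pi$ for which there are no indices $i<j$ with $\pi_j<\pi_i<\pi_{i+1}$ and $\pi_i=\pi_j+1$. -}

module Defs where

open import Data.Nat using (ℕ; zero; suc)
open import Data.Fin using (Fin; toℕ; _<_)
open import Data.Fin.Permutation using (Permutation′; _⟨$⟩ʳ_)
open import Data.Product using (Σ; ∃; _×_; _,_)
open import Relation.Binary.PropositionalEquality using (_≡_)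
open import Relation.Nullary using (¬_)

-- A permutation of [n] is a bijection Fin n → Fin n; position i (0-based)
-- holds value π ⟨$⟩ʳ i (0-based, so value 0 stands for the paper's 1).

Contains321 : {n : ℕ} → Permutation′ n → Set
Contains321 {n} π =
  Σ (Fin n) λ i → Σ (Fin n) λ j → Σ (Fin n) λ k →
    (i < j) × (j < k) × ((π ⟨$⟩ʳ j) < (π ⟨$⟩ʳ i)) × ((π ⟨$⟩ʳ k) < (π ⟨$⟩ʳ j))

Avoids321 : {n : ℕ} → Permutation′ n → Set
Avoids321 π = ¬ Contains321 π

IsFishburn : {n : ℕ} → Permutation′ n → Set
IsFishburn {n} π =
  (i i' j : Fin n) → toℕ i' ≡ suc (toℕ i) → i < j →
    ¬ ( ((π ⟨$⟩ʳ j) < (π ⟨$⟩ʳ i))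
      × ((π ⟨$⟩ʳ i) < (π ⟨$⟩ʳ i'))
      × (toℕ (π ⟨$⟩ʳ i) ≡ suc (toℕ (π ⟨$⟩ʳ j))) )

{-# OPTIONS --safe #-}
-- If π₁ < π₂, the Fishburn condition at the ascent in position 1 forces the
-- value π₁ − 1 to occur before position 1, which is impossible unless π₁ = 1.
-- If π₁ > π₂, then π₁ π₂ is a descent, and 321-avoidance forces every value
-- below π₂ to occur before position 2, i.e. at position 1, which is impossible
-- unless π₂ = 1.
module Submission where

open import Defs
open import Data.Nat using (ℕ; zero; suc; z<s)
import Data.Nat.Properties as ℕ
open import Data.Fin using (Fin; toℕ; _<_)
open import Data.Fin.Properties using (<-cmp; <-irrefl; toℕ-injective; toℕ-inject₁)
open import Data.Fin.Permutation using (Permutation′; _⟨$⟩ʳ_; _⟨$⟩ˡ_; inverseʳ; inverseˡ)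
open import Data.Sum using (_⊎_; inj₁; inj₂)
open import Data.Product using (Σ; _×_; _,_)
open import Data.Empty using (⊥-elim)
open import Relation.Binary.Definitions using (tri<; tri≈; tri>)
open import Relation.Binary.PropositionalEquality using (_≡_; refl; sym; trans; cong; subst; subst₂)

private
  variable
    n : ℕ

⟨$⟩ʳ-injective : (π : Permutation′ n) {i j : Fin n} → π ⟨$⟩ʳ i ≡ π ⟨$⟩ʳ j → i ≡ j
⟨$⟩ʳ-injective π {i} {j} eq =
  trans (sym (inverseˡ π)) (trans (cong (π ⟨$⟩ˡ_) eq) (inverseˡ π))

fishburn-ascent⇒pred-before : (π : Permutation′ n) → IsFishburn π →
  {i i′ v : Fin n} → toℕ i′ ≡ suc (toℕ i) → π ⟨$⟩ʳ i < π ⟨$⟩ʳ i′ →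
  toℕ (π ⟨$⟩ʳ i) ≡ suc (toℕ v) → π ⟨$⟩ˡ v < i
fishburn-ascent⇒pred-before π fishburn {i} {i′} {v} i′≡i+1 ascent πi≡1+v
  with <-cmp (π ⟨$⟩ˡ v) i
... | tri< p<i _ _ = p<i
... | tri≈ _ p≡i _ = ⊥-elim (ℕ.1+n≢n 1+v≡v)
  where
  1+v≡v : suc (toℕ v) ≡ toℕ v
  1+v≡v = trans (sym πi≡1+v)
    (cong toℕ (trans (cong (π ⟨$⟩ʳ_) (sym p≡i)) (inverseʳ π)))
... | tri> _ _ i<p = ⊥-elim (fishburn i i′ (π ⟨$⟩ˡ v) i′≡i+1 i<p
  (below , ascent , subst (λ w → toℕ (π ⟨$⟩ʳ i) ≡ suc (toℕ w)) (sym (inverseʳ π)) πi≡1+v))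
  where
  below : π ⟨$⟩ʳ (π ⟨$⟩ˡ v) < π ⟨$⟩ʳ i
  below rewrite inverseʳ π {v} | πi≡1+v = ℕ.n<1+n (toℕ v)

avoids321-descent⇒smaller-before : (π : Permutation′ n) → Avoids321 π →
  {i j k : Fin n} → i < j → π ⟨$⟩ʳ j < π ⟨$⟩ʳ i → π ⟨$⟩ʳ k < π ⟨$⟩ʳ j → k < j
avoids321-descent⇒smaller-before π avoids {i} {j} {k} i<j descent πk<πj
  with <-cmp k j
... | tri< k<j _ _ = k<j
... | tri≈ _ refl _ = ⊥-elim (<-irrefl refl πk<πj)
... | tri> _ _ j<k = ⊥-elim (avoids (i , j , k , i<j , j<k , descent , πk<πj))

first-ascent⇒first-is-min : (m : ℕ) (π : Permutation′ (suc (suc m))) → IsFishburn π →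
  π ⟨$⟩ʳ Fin.zero < π ⟨$⟩ʳ Fin.suc Fin.zero → toℕ (π ⟨$⟩ʳ Fin.zero) ≡ 0
first-ascent⇒first-is-min m π fishburn ascent with π ⟨$⟩ʳ Fin.zero in π₀≡
... | Fin.zero = refl
... | Fin.suc w = ⊥-elim (ℕ.n≮0 (fishburn-ascent⇒pred-before π fishburn refl
  (subst (λ x → x < π ⟨$⟩ʳ Fin.suc Fin.zero) (sym π₀≡) ascent)
  (trans (cong toℕ π₀≡) (cong suc (sym (toℕ-inject₁ w))))))

first-descent⇒second-is-min : (m : ℕ) (π : Permutation′ (suc (suc m))) → Avoids321 π →
  π ⟨$⟩ʳ Fin.suc Fin.zero < π ⟨$⟩ʳ Fin.zero → toℕ (π ⟨$⟩ʳ Fin.suc Fin.zero) ≡ 0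
first-descent⇒second-is-min m π avoids descent with π ⟨$⟩ʳ Fin.suc Fin.zero in π₁≡
... | Fin.zero = refl
... | Fin.suc w = ⊥-elim (ℕ.n≮0 (subst (Fin.suc w <_) min-first descent))
  where
  min-at-first : π ⟨$⟩ˡ Fin.zero ≡ Fin.zero
  min-at-first = toℕ-injective (ℕ.n<1⇒n≡0 (avoids321-descent⇒smaller-before π avoids z<s
    (subst (_< π ⟨$⟩ʳ Fin.zero) (sym π₁≡) descent)
    (subst₂ _<_ (sym (inverseʳ π)) (sym π₁≡) z<s)))
  min-first : π ⟨$⟩ʳ Fin.zero ≡ Fin.zero
  min-first = trans (cong (π ⟨$⟩ʳ_) (sym min-at-first)) (inverseʳ π)

lemma1p1 : (m : ℕ) (π : Permutation′ (suc m)) → IsFishburn π → Avoids321 π →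
    (toℕ (π ⟨$⟩ʳ Fin.zero) ≡ 0)
    ⊎ (Σ (Fin (suc m)) λ p → (toℕ p ≡ 1) × (toℕ (π ⟨$⟩ʳ p) ≡ 0))
lemma1p1 zero π _ _ with π ⟨$⟩ʳ Fin.zero
... | Fin.zero = inj₁ refl
lemma1p1 (suc m) π fishburn avoids with <-cmp (π ⟨$⟩ʳ Fin.zero) (π ⟨$⟩ʳ Fin.suc Fin.zero)
... | tri< ascent _ _ = inj₁ (first-ascent⇒first-is-min m π fishburn ascent)
... | tri≈ _ same _ with ⟨$⟩ʳ-injective π same
...   | ()
lemma1p1 (suc m) π fishburn avoids | tri> _ _ descent =
  inj₂ (Fin.suc Fin.zero , refl , first-descent⇒second-is-min m π avoids descent)
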